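{- For every integer $m\ge 0$ and positive integer $q$, with $Q=\{2,q\}$, $$\binom{m,2}{2,Q}=m^2+(m+1)^2+\cdots+(m+q-1)^2,$$ i.e. $\binom{m,2}{2,\{2,q\}}$ is a truncated square pyramidal number.
   Context: For a finite list $Q=\{q_1,\dots,q_n\}$ of positive integers (repetitions allowed) and a nonnegative integer $m$, let $X$ be a set which is the disjoint union of "main blocks" $X_1,\dots,X_n$ with $|X_i|=q_i$ and an "additional block" $Y$ with $|Y|=m$. An $(n+k)$-inset of $X$ is an $(n+k)$-element subset of $X$ that intersects every main block. The number of $(n+k)$-insets of $X$ is denoted $\binom{m,n}{k,Q}$. Here $n=2$, the main blocks have sizes $2$ and $q$, and one counts $4$-insets. -}

module Defs where

open import Data.Nat using (ℕ; zero; suc; _+_; _*_)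
open import Data.List using (List; []; _∷_; length; filter; concatMap; map; upTo)
open import Data.Nat.ListAction using (sum)
open import Data.Product using (_×_; _,_; proj₁; proj₂)
open import Data.Fin.Subset using (Subset; ∣_∣; Nonempty)
open import Data.Fin.Subset.Properties using (nonempty?)
open import Data.Vec using (Vec; []; _∷_)
open import Data.Bool using (true; false)
open import Data.Unit using (⊤; tt)
open import Relation.Nullary using (Dec; yes; no)
open import Relation.Nullary.Decidable using (_×-dec_)
open import Relation.Binary.PropositionalEquality using (_≡_)
import Data.Nat.Properties as ℕP

allSubsets : (n : ℕ) → List (Subset n)
allSubsets zero = [] ∷ []
allSubsets (suc n) = concatMap (λ s → (false ∷ s) ∷ (true ∷ s) ∷ []) (allSubsets n)

-- A subset of the disjoint union X₁ ⊔ … ⊔ Xₙ ⊔ Y with |Xᵢ| = qᵢ, |Y| = m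
-- is the same as a tuple of subsets, one for each block.
Blocks : List ℕ → Set
Blocks [] = ⊤
Blocks (q ∷ Q) = Subset q × Blocks Q

SubsetOfX : List ℕ → ℕ → Set
SubsetOfX Q m = Blocks Q × Subset m

allBlocks : (Q : List ℕ) → List (Blocks Q)
allBlocks [] = tt ∷ []
allBlocks (q ∷ Q) = concatMap (λ s → map (λ r → (s , r)) (allBlocks Q)) (allSubsets q)

allSubsetsOfX : (Q : List ℕ) (m : ℕ) → List (SubsetOfX Q m)
allSubsetsOfX Q m = concatMap (λ b → map (λ y → (b , y)) (allSubsets m)) (allBlocks Q)

cardBlocks : (Q : List ℕ) → Blocks Q → ℕ
cardBlocks [] _ = 0
cardBlocks (q ∷ Q) (s , r) = ∣ s ∣ + cardBlocks Q r

card : (Q : List ℕ) (m : ℕ) → SubsetOfX Q m → ℕ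
card Q m (b , y) = cardBlocks Q b + ∣ y ∣

MeetsAll : (Q : List ℕ) → Blocks Q → Set
MeetsAll [] _ = ⊤
MeetsAll (q ∷ Q) (s , r) = Nonempty s × MeetsAll Q r

meetsAll? : (Q : List ℕ) → (b : Blocks Q) → Dec (MeetsAll Q b)
meetsAll? [] _ = yes tt
meetsAll? (q ∷ Q) (s , r) = nonempty? s ×-dec meetsAll? Q r

IsInset : (Q : List ℕ) (m k : ℕ) → SubsetOfX Q m → Set
IsInset Q m k S = (card Q m S ≡ length Q + k) × MeetsAll Q (proj₁ S)

isInset? : (Q : List ℕ) (m k : ℕ) → (S : SubsetOfX Q m) → Dec (IsInset Q m k S)
isInset? Q m k S = (card Q m S ℕP.≟ (length Q + k)) ×-dec meetsAll? Q (proj₁ S)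

-- the number of (n+k)-insets:  binom{m,n}{k,Q}  with n = length Q
insetCount : (m k : ℕ) (Q : List ℕ) → ℕ
insetCount m k Q = length (filter (isInset? Q m k) (allSubsetsOfX Q m))

truncPyramidal : ℕ → ℕ → ℕ
truncPyramidal m q = sum (map (λ i → (m + i) * (m + i)) (upTo q))

module Submission where

open import Defs
import Data.Nat.Properties as ℕ
open import Algebra.Properties.CommutativeSemigroup ℕ.+-commutativeSemigroup using (interchange)
open import Data.Bool using (Bool; true; false; if_then_else_; _∧_)
open import Data.Bool.Properties using (∧-zeroʳ; ∧-identityʳ)
open import Data.Fin.Subset using (Subset; ∣_∣; ⊥)
open import Data.Fin.Subset.Properties using (nonempty?; Empty-unique; ∣⊥∣≡0; x∈p⇒∣p-x∣<∣p∣)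
open import Data.List using (List; []; _∷_; map; concatMap; filter; length; upTo; [_]; _++_)
open import Data.List.Properties using (map-cong; map-∘; map-++; upTo-∷ʳ)
open import Data.Nat using (ℕ; zero; suc; _+_; _*_; _<_; _≡ᵇ_; s≤s)
open import Data.Nat.Combinatorics using (_C_; nC1≡n; nCk+nC[k+1]≡[n+1]C[k+1])
open import Data.Nat.ListAction using (sum)
open import Data.Nat.ListAction.Properties using (sum-++)
open import Data.Nat.Tactic.RingSolver using (solve-∀)
open import Data.Product using (_,_)
open import Data.Vec using (_∷_)
open import Function using (_∘_)
open import Relation.Binary.PropositionalEquality using (_≡_; refl; sym; trans; cong; cong₂; module ≡-Reasoning)
open import Relation.Nullary using (does; yes; no)
open import Relation.Unary using (Decidable)

open ≡-Reasoning

-- Counted by cardinalities, an inset is a choice of nonempty parts of X₁ and X₂ and a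
-- part of Y of the right total size.  Dropping the requirement that the part of X₂ be
-- nonempty merges X₂ into Y; so, by Vandermonde's identity, the j-subsets of X₁ ⊔ X₂ ⊔ Y
-- meeting X₁ and X₂, together with the j-subsets of X₁ ⊔ Y meeting X₁, are exactly the
-- j-subsets of X₁ ⊔ (X₂ ∪ Y) meeting X₁.  For |X₁| = 2 and j = 4 the number of j-subsets
-- of X₁ ⊔ Z meeting X₁ is 2 C(n,3) + C(n,2) = 0² + 1² + ⋯ + (n-1)² where n = |Z|, and the
-- theorem is the difference of two such square sums.

indicator : Bool → ℕ
indicator true = 1
indicator false = 0

indicator-∧ : ∀ a c → indicator (a ∧ c) ≡ (if c then indicator a else 0)
indicator-∧ a true = cong indicator (∧-identityʳ a)
indicator-∧ a false = cong indicator (∧-zeroʳ a)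

if-∧ : ∀ a b (x : ℕ) → (if a ∧ b then x else 0) ≡ (if a then (if b then x else 0) else 0)
if-∧ true b x = refl
if-∧ false b x = refl

length-filter : ∀ {A : Set} {P : A → Set} (P? : Decidable P) (xs : List A) →
                length (filter P? xs) ≡ sum (map (indicator ∘ does ∘ P?) xs)
length-filter P? [] = refl
length-filter P? (x ∷ xs) with does (P? x)
... | true = cong suc (length-filter P? xs)
... | false = length-filter P? xs

sum-map-concatMap : ∀ {A B : Set} (f : B → ℕ) (g : A → List B) (xs : List A) →
                    sum (map f (concatMap g xs)) ≡ sum (map (sum ∘ map f ∘ g) xs)
sum-map-concatMap f g [] = refl
sum-map-concatMap f g (x ∷ xs) = begin
  sum (map f (g x ++ concatMap g xs))
    ≡⟨ cong sum (map-++ f (g x) (concatMap g xs)) ⟩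
  sum (map f (g x) ++ map f (concatMap g xs))
    ≡⟨ sum-++ (map f (g x)) (map f (concatMap g xs)) ⟩
  sum (map f (g x)) + sum (map f (concatMap g xs))
    ≡⟨ cong (sum (map f (g x)) +_) (sum-map-concatMap f g xs) ⟩
  sum (map f (g x)) + sum (map (sum ∘ map f ∘ g) xs) ∎

sum-map-+ : ∀ {A : Set} (f g : A → ℕ) (xs : List A) →
            sum (map (λ x → f x + g x) xs) ≡ sum (map f xs) + sum (map g xs)
sum-map-+ f g [] = refl
sum-map-+ f g (x ∷ xs) =
  trans (cong (f x + g x +_) (sum-map-+ f g xs)) (interchange (f x) (g x) _ _)

sum-map-if : ∀ {A : Set} (c : Bool) (f : A → ℕ) (xs : List A) →
             sum (map (λ x → if c then f x else 0) xs) ≡ (if c then sum (map f xs) else 0)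
sum-map-if true f xs = refl
sum-map-if false f [] = refl
sum-map-if false f (x ∷ xs) = sum-map-if false f xs

-- sumByCard n f = Σₖ (n C k) * f k, i.e. the sum of f ∣ s ∣ over all subsets s of an n-set.
sumByCard : ℕ → (ℕ → ℕ) → ℕ
sumByCard zero f = f 0
sumByCard (suc n) f = sumByCard n f + sumByCard n (f ∘ suc)

sum-allSubsets : ∀ n (f : ℕ → ℕ) → sum (map (f ∘ ∣_∣) (allSubsets n)) ≡ sumByCard n f
sum-allSubsets zero f = ℕ.+-identityʳ (f 0)
sum-allSubsets (suc n) f = begin
  sum (map (f ∘ ∣_∣) (allSubsets (suc n)))
    ≡⟨ sum-map-concatMap (f ∘ ∣_∣) (λ s → (false ∷ s) ∷ (true ∷ s) ∷ []) (allSubsets n) ⟩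
  sum (map (λ s → f ∣ s ∣ + (f (suc ∣ s ∣) + 0)) (allSubsets n))
    ≡⟨ cong sum (map-cong (λ s → cong (f ∣ s ∣ +_) (ℕ.+-identityʳ _)) (allSubsets n)) ⟩
  sum (map (λ s → f ∣ s ∣ + f (suc ∣ s ∣)) (allSubsets n))
    ≡⟨ sum-map-+ (f ∘ ∣_∣) (f ∘ suc ∘ ∣_∣) (allSubsets n) ⟩
  sum (map (f ∘ ∣_∣) (allSubsets n)) + sum (map (f ∘ suc ∘ ∣_∣) (allSubsets n))
    ≡⟨ cong₂ _+_ (sum-allSubsets n f) (sum-allSubsets n (f ∘ suc)) ⟩
  sumByCard n f + sumByCard n (f ∘ suc) ∎

sumByCard-cong : ∀ n {f g : ℕ → ℕ} → (∀ k → f k ≡ g k) → sumByCard n f ≡ sumByCard n g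
sumByCard-cong zero f≗g = f≗g 0
sumByCard-cong (suc n) f≗g = cong₂ _+_ (sumByCard-cong n f≗g) (sumByCard-cong n (f≗g ∘ suc))

sumByCard-+ : ∀ n (f g : ℕ → ℕ) → sumByCard n (λ k → f k + g k) ≡ sumByCard n f + sumByCard n g
sumByCard-+ zero f g = refl
sumByCard-+ (suc n) f g =
  trans (cong₂ _+_ (sumByCard-+ n f g) (sumByCard-+ n (f ∘ suc) (g ∘ suc)))
    (interchange (sumByCard n f) (sumByCard n g) (sumByCard n (f ∘ suc)) (sumByCard n (g ∘ suc)))

sumByCard-zero : ∀ n → sumByCard n (λ _ → 0) ≡ 0
sumByCard-zero zero = refl
sumByCard-zero (suc n) = cong₂ _+_ (sumByCard-zero n) (sumByCard-zero n)

sumByCard-≡ᵇ : ∀ n j → sumByCard n (λ k → indicator (k ≡ᵇ j)) ≡ n C j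
sumByCard-≡ᵇ zero zero = refl
sumByCard-≡ᵇ zero (suc j) = refl
sumByCard-≡ᵇ (suc n) zero = cong₂ _+_ (sumByCard-≡ᵇ n 0) (sumByCard-zero n)
sumByCard-≡ᵇ (suc n) (suc j) = begin
  sumByCard n (λ k → indicator (k ≡ᵇ suc j)) + sumByCard n (λ k → indicator (k ≡ᵇ j))
    ≡⟨ cong₂ _+_ (sumByCard-≡ᵇ n (suc j)) (sumByCard-≡ᵇ n j) ⟩
  n C suc j + n C j                ≡⟨ ℕ.+-comm (n C suc j) (n C j) ⟩
  n C j + n C suc j                ≡⟨ nCk+nC[k+1]≡[n+1]C[k+1] n j ⟩
  suc n C suc j ∎

sumByCard-vandermonde : ∀ q m (f : ℕ → ℕ) →
                        sumByCard q (λ b → sumByCard m (λ c → f (b + c))) ≡ sumByCard (q + m) f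
sumByCard-vandermonde zero m f = refl
sumByCard-vandermonde (suc q) m f =
  cong₂ _+_ (sumByCard-vandermonde q m f) (sumByCard-vandermonde q m (f ∘ suc))

nonzeroPart : (ℕ → ℕ) → ℕ → ℕ
nonzeroPart f zero = 0
nonzeroPart f (suc n) = f (suc n)

nonzeroPart-cong : ∀ {f g : ℕ → ℕ} → (∀ k → f k ≡ g k) → ∀ k → nonzeroPart f k ≡ nonzeroPart g k
nonzeroPart-cong f≗g zero = refl
nonzeroPart-cong f≗g (suc k) = f≗g (suc k)

nonzeroPart-+ : ∀ (f g : ℕ → ℕ) k →
                nonzeroPart f k + nonzeroPart g k ≡ nonzeroPart (λ i → f i + g i) k
nonzeroPart-+ f g zero = refl
nonzeroPart-+ f g (suc k) = refl

sumByCard-nonzeroPart : ∀ n (f : ℕ → ℕ) → sumByCard n f ≡ f 0 + sumByCard n (nonzeroPart f)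
sumByCard-nonzeroPart zero f = sym (ℕ.+-identityʳ (f 0))
sumByCard-nonzeroPart (suc n) f =
  trans (cong (_+ sumByCard n (f ∘ suc)) (sumByCard-nonzeroPart n f)) (ℕ.+-assoc (f 0) _ _)

sumByCard-vandermonde-nonzero : ∀ q m (f : ℕ → ℕ) →
  sumByCard q (nonzeroPart (λ b → sumByCard m (λ c → f (b + c)))) + sumByCard m f ≡ sumByCard (q + m) f
sumByCard-vandermonde-nonzero q m f = begin
  sumByCard q (nonzeroPart g) + sumByCard m f ≡⟨ ℕ.+-comm (sumByCard q (nonzeroPart g)) _ ⟩
  g 0 + sumByCard q (nonzeroPart g)           ≡⟨ sym (sumByCard-nonzeroPart q g) ⟩
  sumByCard q g                               ≡⟨ sumByCard-vandermonde q m f ⟩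
  sumByCard (q + m) f ∎
  where
  g : ℕ → ℕ
  g b = sumByCard m (λ c → f (b + c))

-- meetingSum Q f is the sum of f (cardBlocks Q b) over the tuples b meeting every block.
meetingSum : List ℕ → (ℕ → ℕ) → ℕ
meetingSum [] f = f 0
meetingSum (q ∷ Q) f = sumByCard q (nonzeroPart (λ a → meetingSum Q (λ t → f (a + t))))

nonzeroPart-card : ∀ n (g : ℕ → ℕ) (s : Subset n) →
                   (if does (nonempty? s) then g ∣ s ∣ else 0) ≡ nonzeroPart g ∣ s ∣
nonzeroPart-card n g s with nonempty? s
... | yes (x , x∈s) = nonzeroPart-< (x∈p⇒∣p-x∣<∣p∣ x∈s)
  where
  nonzeroPart-< : ∀ {i j} → i < j → g j ≡ nonzeroPart g j
  nonzeroPart-< (s≤s _) = refl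
... | no s-empty = helper (Empty-unique s-empty)
  where
  helper : s ≡ ⊥ → 0 ≡ nonzeroPart g ∣ s ∣
  helper refl = cong (nonzeroPart g) (sym (∣⊥∣≡0 n))

meetingSum-blocks : ∀ Q (f : ℕ → ℕ) →
  sum (map (λ b → if does (meetsAll? Q b) then f (cardBlocks Q b) else 0) (allBlocks Q)) ≡ meetingSum Q f
meetingSum-blocks [] f = ℕ.+-identityʳ (f 0)
meetingSum-blocks (q ∷ Q) f = begin
  sum (map φ (concatMap (λ s → map (s ,_) (allBlocks Q)) (allSubsets q)))
    ≡⟨ sum-map-concatMap φ (λ s → map (s ,_) (allBlocks Q)) (allSubsets q) ⟩
  sum (map (λ s → sum (map φ (map (s ,_) (allBlocks Q)))) (allSubsets q))
    ≡⟨ cong sum (map-cong perSubset (allSubsets q)) ⟩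
  sum (map (nonzeroPart g ∘ ∣_∣) (allSubsets q))
    ≡⟨ sum-allSubsets q (nonzeroPart g) ⟩
  sumByCard q (nonzeroPart g) ∎
  where
  φ : Blocks (q ∷ Q) → ℕ
  φ b = if does (meetsAll? (q ∷ Q) b) then f (cardBlocks (q ∷ Q) b) else 0
  g : ℕ → ℕ
  g a = meetingSum Q (λ t → f (a + t))
  perSubset : ∀ s → sum (map φ (map (s ,_) (allBlocks Q))) ≡ nonzeroPart g ∣ s ∣
  perSubset s = begin
    sum (map φ (map (s ,_) (allBlocks Q)))
      ≡⟨ cong sum (sym (map-∘ (allBlocks Q))) ⟩
    sum (map (φ ∘ (s ,_)) (allBlocks Q))
      ≡⟨ cong sum (map-cong (λ r → if-∧ (does (nonempty? s)) _ _) (allBlocks Q)) ⟩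
    sum (map (λ r → if does (nonempty? s) then φ′ r else 0) (allBlocks Q))
      ≡⟨ sum-map-if (does (nonempty? s)) φ′ (allBlocks Q) ⟩
    (if does (nonempty? s) then sum (map φ′ (allBlocks Q)) else 0)
      ≡⟨ cong (λ x → if does (nonempty? s) then x else 0) (meetingSum-blocks Q (λ t → f (∣ s ∣ + t))) ⟩
    (if does (nonempty? s) then g ∣ s ∣ else 0)
      ≡⟨ nonzeroPart-card q g s ⟩
    nonzeroPart g ∣ s ∣ ∎
    where
    φ′ : Blocks Q → ℕ
    φ′ r = if does (meetsAll? Q r) then f (∣ s ∣ + cardBlocks Q r) else 0

insetCount≡meetingSum : ∀ m k Q →
  insetCount m k Q ≡ meetingSum Q (λ t → sumByCard m (λ c → indicator (t + c ≡ᵇ length Q + k)))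
insetCount≡meetingSum m k Q = begin
  length (filter P? (allSubsetsOfX Q m))
    ≡⟨ length-filter P? (allSubsetsOfX Q m) ⟩
  sum (map χ (allSubsetsOfX Q m))
    ≡⟨ sum-map-concatMap χ (λ b → map (b ,_) (allSubsets m)) (allBlocks Q) ⟩
  sum (map (λ b → sum (map χ (map (b ,_) (allSubsets m)))) (allBlocks Q))
    ≡⟨ cong sum (map-cong perBlock (allBlocks Q)) ⟩
  sum (map (λ b → if does (meetsAll? Q b) then F (cardBlocks Q b) else 0) (allBlocks Q))
    ≡⟨ meetingSum-blocks Q F ⟩
  meetingSum Q F ∎
  where
  P? = isInset? Q m k
  χ : SubsetOfX Q m → ℕ
  χ = indicator ∘ does ∘ P?
  F : ℕ → ℕ
  F t = sumByCard m (λ c → indicator (t + c ≡ᵇ length Q + k))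
  perBlock : ∀ b → sum (map χ (map (b ,_) (allSubsets m))) ≡ (if does (meetsAll? Q b) then F (cardBlocks Q b) else 0)
  perBlock b = begin
    sum (map χ (map (b ,_) (allSubsets m)))
      ≡⟨ cong sum (sym (map-∘ (allSubsets m))) ⟩
    sum (map (λ y → indicator ((cardBlocks Q b + ∣ y ∣ ≡ᵇ length Q + k) ∧ meets)) (allSubsets m))
      ≡⟨ cong sum (map-cong (λ y → indicator-∧ _ meets) (allSubsets m)) ⟩
    sum (map (λ y → if meets then indicator (cardBlocks Q b + ∣ y ∣ ≡ᵇ length Q + k) else 0) (allSubsets m))
      ≡⟨ sum-map-if meets _ (allSubsets m) ⟩
    (if meets then sum (map (λ y → indicator (cardBlocks Q b + ∣ y ∣ ≡ᵇ length Q + k)) (allSubsets m)) else 0)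
      ≡⟨ cong (λ x → if meets then x else 0) (sum-allSubsets m _) ⟩
    (if meets then F (cardBlocks Q b) else 0) ∎
    where
    meets = does (meetsAll? Q b)

meetingSum-merge : ∀ p q m (f : ℕ → ℕ) →
  meetingSum (p ∷ q ∷ []) (λ t → sumByCard m (λ c → f (t + c)))
    + meetingSum (p ∷ []) (λ t → sumByCard m (λ c → f (t + c)))
  ≡ meetingSum (p ∷ []) (λ t → sumByCard (q + m) (λ c → f (t + c)))
meetingSum-merge p q m f = begin
  sumByCard p (nonzeroPart G) + sumByCard p (nonzeroPart H)
    ≡⟨ sym (sumByCard-+ p (nonzeroPart G) (nonzeroPart H)) ⟩
  sumByCard p (λ a → nonzeroPart G a + nonzeroPart H a)
    ≡⟨ sumByCard-cong p (nonzeroPart-+ G H) ⟩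
  sumByCard p (nonzeroPart (λ a → G a + H a))
    ≡⟨ sumByCard-cong p (nonzeroPart-cong mergeAt) ⟩
  sumByCard p (nonzeroPart (λ a → sumByCard (q + m) (λ c → f (a + 0 + c)))) ∎
  where
  G H : ℕ → ℕ
  G a = sumByCard q (nonzeroPart (λ b → sumByCard m (λ c → f (a + (b + 0) + c))))
  H a = sumByCard m (λ c → f (a + 0 + c))
  reassociate : ∀ a b c → a + (b + 0) + c ≡ a + 0 + (b + c)
  reassociate = solve-∀
  mergeAt : ∀ a → G a + H a ≡ sumByCard (q + m) (λ c → f (a + 0 + c))
  mergeAt a = trans
    (cong (_+ H a) (sumByCard-cong q (nonzeroPart-cong (λ b →
      sumByCard-cong m (λ c → cong f (reassociate a b c))))))
    (sumByCard-vandermonde-nonzero q m (λ c → f (a + 0 + c)))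

insetCount-merge : ∀ p q m k →
  insetCount m k (p ∷ q ∷ []) + insetCount m (suc k) (p ∷ []) ≡ insetCount (q + m) (suc k) (p ∷ [])
insetCount-merge p q m k = begin
  insetCount m k (p ∷ q ∷ []) + insetCount m (suc k) (p ∷ [])
    ≡⟨ cong₂ _+_ (insetCount≡meetingSum m k (p ∷ q ∷ [])) (insetCount≡meetingSum m (suc k) (p ∷ [])) ⟩
  meetingSum (p ∷ q ∷ []) (λ t → sumByCard m (λ c → f (t + c)))
    + meetingSum (p ∷ []) (λ t → sumByCard m (λ c → f (t + c)))
    ≡⟨ meetingSum-merge p q m f ⟩
  meetingSum (p ∷ []) (λ t → sumByCard (q + m) (λ c → f (t + c)))
    ≡⟨ sym (insetCount≡meetingSum (q + m) (suc k) (p ∷ [])) ⟩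
  insetCount (q + m) (suc k) (p ∷ []) ∎
  where
  f : ℕ → ℕ
  f i = indicator (i ≡ᵇ suc (suc k))

squareSum : ℕ → ℕ
squareSum = truncPyramidal 0

truncPyramidal-suc : ∀ a n → truncPyramidal a (suc n) ≡ truncPyramidal a n + (a + n) * (a + n)
truncPyramidal-suc a n = begin
  sum (map sq (upTo (suc n)))                 ≡⟨ cong (sum ∘ map sq) (sym (upTo-∷ʳ n)) ⟩
  sum (map sq (upTo n ++ [ n ]))    ≡⟨ cong sum (map-++ sq (upTo n) [ n ]) ⟩
  sum (map sq (upTo n) ++ [ sq n ]) ≡⟨ sum-++ (map sq (upTo n)) [ sq n ] ⟩
  truncPyramidal a n + (sq n + 0)             ≡⟨ cong (truncPyramidal a n +_) (ℕ.+-identityʳ (sq n)) ⟩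
  truncPyramidal a n + sq n ∎
  where
  sq : ℕ → ℕ
  sq i = (a + i) * (a + i)

squareSum-split : ∀ m q → squareSum m + truncPyramidal m q ≡ squareSum (q + m)
squareSum-split m zero = ℕ.+-identityʳ (squareSum m)
squareSum-split m (suc q) = begin
  squareSum m + truncPyramidal m (suc q)
    ≡⟨ cong (squareSum m +_) (truncPyramidal-suc m q) ⟩
  squareSum m + (truncPyramidal m q + (m + q) * (m + q))
    ≡⟨ sym (ℕ.+-assoc (squareSum m) _ _) ⟩
  squareSum m + truncPyramidal m q + (m + q) * (m + q)
    ≡⟨ cong₂ (λ x y → x + y * y) (squareSum-split m q) (ℕ.+-comm m q) ⟩
  squareSum (q + m) + (q + m) * (q + m)
    ≡⟨ sym (truncPyramidal-suc 0 (q + m)) ⟩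
  squareSum (suc q + m) ∎

nC2+nC2+n≡n*n : ∀ n → n C 2 + n C 2 + n ≡ n * n
nC2+nC2+n≡n*n zero = refl
nC2+nC2+n≡n*n (suc n) = begin
  suc n C 2 + suc n C 2 + suc n
    ≡⟨ cong (λ x → x + x + suc n) (sym (nCk+nC[k+1]≡[n+1]C[k+1] n 1)) ⟩
  (n C 1 + n C 2) + (n C 1 + n C 2) + suc n
    ≡⟨ cong (λ x → (x + n C 2) + (x + n C 2) + suc n) (nC1≡n n) ⟩
  (n + n C 2) + (n + n C 2) + suc n
    ≡⟨ regroup n (n C 2) ⟩
  (n C 2 + n C 2 + n) + (n + n + 1)
    ≡⟨ cong (_+ (n + n + 1)) (nC2+nC2+n≡n*n n) ⟩
  n * n + (n + n + 1)
    ≡⟨ square-suc n ⟩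
  suc n * suc n ∎
  where
  regroup : ∀ n c → (n + c) + (n + c) + suc n ≡ (c + c + n) + (n + n + 1)
  regroup = solve-∀
  square-suc : ∀ n → n * n + (n + n + 1) ≡ suc n * suc n
  square-suc = solve-∀

squareSum-binomial : ∀ n → n C 3 + (n C 3 + n C 2) ≡ squareSum n
squareSum-binomial zero = refl
squareSum-binomial (suc n) = begin
  suc n C 3 + (suc n C 3 + suc n C 2)
    ≡⟨ cong₂ (λ x y → x + (x + y)) (sym (nCk+nC[k+1]≡[n+1]C[k+1] n 2)) (sym (nCk+nC[k+1]≡[n+1]C[k+1] n 1)) ⟩
  (n C 2 + n C 3) + ((n C 2 + n C 3) + (n C 1 + n C 2))
    ≡⟨ cong (λ x → (n C 2 + n C 3) + ((n C 2 + n C 3) + (x + n C 2))) (nC1≡n n) ⟩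
  (n C 2 + n C 3) + ((n C 2 + n C 3) + (n + n C 2))
    ≡⟨ regroup (n C 3) (n C 2) n ⟩
  (n C 3 + (n C 3 + n C 2)) + (n C 2 + n C 2 + n)
    ≡⟨ cong₂ _+_ (squareSum-binomial n) (nC2+nC2+n≡n*n n) ⟩
  squareSum n + n * n
    ≡⟨ sym (truncPyramidal-suc 0 n) ⟩
  squareSum (suc n) ∎
  where
  regroup : ∀ c₃ c₂ n → (c₂ + c₃) + ((c₂ + c₃) + (n + c₂)) ≡ (c₃ + (c₃ + c₂)) + (c₂ + c₂ + n)
  regroup = solve-∀

insetCount-pair≡squareSum : ∀ n → insetCount n 3 (2 ∷ []) ≡ squareSum n
insetCount-pair≡squareSum n = begin
  insetCount n 3 (2 ∷ [])
    ≡⟨ insetCount≡meetingSum n 3 (2 ∷ []) ⟩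
  sumByCard n (λ c → indicator (c ≡ᵇ 3))
    + (sumByCard n (λ c → indicator (c ≡ᵇ 3)) + sumByCard n (λ c → indicator (c ≡ᵇ 2)))
    ≡⟨ cong₂ (λ x y → x + (x + y)) (sumByCard-≡ᵇ n 3) (sumByCard-≡ᵇ n 2) ⟩
  n C 3 + (n C 3 + n C 2)
    ≡⟨ squareSum-binomial n ⟩
  squareSum n ∎

mainTheorem13 : (m q : ℕ) → insetCount m 2 (2 ∷ suc q ∷ []) ≡ truncPyramidal m (suc q)
mainTheorem13 m q = ℕ.+-cancelʳ-≡ (squareSum m) _ _ (begin
  insetCount m 2 (2 ∷ suc q ∷ []) + squareSum m
    ≡⟨ cong (insetCount m 2 (2 ∷ suc q ∷ []) +_) (sym (insetCount-pair≡squareSum m)) ⟩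
  insetCount m 2 (2 ∷ suc q ∷ []) + insetCount m 3 (2 ∷ [])
    ≡⟨ insetCount-merge 2 (suc q) m 2 ⟩
  insetCount (suc q + m) 3 (2 ∷ [])
    ≡⟨ insetCount-pair≡squareSum (suc q + m) ⟩
  squareSum (suc q + m)
    ≡⟨ sym (squareSum-split m (suc q)) ⟩
  squareSum m + truncPyramidal m (suc q)
    ≡⟨ ℕ.+-comm (squareSum m) _ ⟩
  truncPyramidal m (suc q) + squareSum m ∎)
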